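{- Let $k\ge 4$ be an integer. Then $\mathrm{URT}(k)\ge \frac{k-1}{k-2}$, and the longest word over $\Sigma_k=\{\mathtt{1},\dots,\mathtt{k}\}$ that is undirected $\frac{k-1}{k-2}$-free has length $k+3$.
   Context: For a word $x=x_1\cdots x_n$ (the $x_i$ letters), its reversal is $x^R=x_n\cdots x_1$. For a rational number $1<r\le 2$, an undirected $r$-power is a word of the form $xyx'$ where $x$ is a nonempty word, $x'\in\{x,x^R\}$, and $|xyx'|/|xy|=r$. A word $w$ is undirected $\alpha$-free if no factor of $w$ is an undirected $r$-power with $r\ge\alpha$. Undirected $\alpha$-powers are $k$-avoidable if there exists an infinite word over a $k$-letter alphabet that is undirected $\alpha$-free. The undirected repetition threshold is $\mathrm{URT}(k)=\inf\{r : \text{undirected } r\text{ -powers are } k\text{ -avoidable}\}$. -}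

module Defs where

open import Data.Nat using (ℕ; zero; suc; _+_)
open import Data.Integer using (+_)
open import Data.Rational using (ℚ; _/_; 0ℚ; _≤_)
open import Data.List using (List; []; _∷_; _++_; length; reverse)
open import Data.Fin using (Fin; toℕ)
open import Data.Product using (Σ; _×_; ∃)
open import Data.Sum using (_⊎_)
open import Relation.Binary.PropositionalEquality using (_≡_; _≢_)
open import Relation.Nullary using (¬_)

-- the rational number n / d (d is always nonzero where used; 0 otherwise)
ratio : ℕ → ℕ → ℚ
ratio n zero    = 0ℚ
ratio n (suc d) = (+ n) / suc d

exponent : {A : Set} → List A → List A → List A → ℚ
exponent x y x' = ratio (length (x ++ y ++ x')) (length (x ++ y))

UPowerAtLeast : {A : Set} → ℚ → List A → Set
UPowerAtLeast {A} α v =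
  Σ (List A) λ x → Σ (List A) λ y → Σ (List A) λ x' →
    (v ≡ x ++ y ++ x') × (x ≢ []) × ((x' ≡ x) ⊎ (x' ≡ reverse x)) ×
    (α ≤ exponent x y x')

UFree : {A : Set} → ℚ → List A → Set
UFree {A} α w =
  (u v z : List A) → w ≡ u ++ v ++ z → ¬ UPowerAtLeast α v

prefix : {A : Set} → (ℕ → A) → ℕ → List A
prefix f zero    = []
prefix f (suc n) = f 0 ∷ prefix (λ i → f (suc i)) n

-- an infinite word is undirected α-free iff all of its finite prefixes are
-- (every factor of an infinite word is a factor of some prefix)
UFreeInf : {A : Set} → ℚ → (ℕ → A) → Set
UFreeInf α f = ∀ n → UFree α (prefix f n)

Avoidable : ℕ → ℚ → Set
Avoidable k α = Σ (ℕ → Fin k) λ f → UFreeInf α f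

-- URT(k) ≥ β  :  β is a lower bound of {r : undirected r-powers are k-avoidable}
URT≥ : ℕ → ℚ → Set
URT≥ k β = ∀ (r : ℚ) → Avoidable k r → β ≤ r

-- Write k for the alphabet size and α = (k-1)/(k-2). An undirected power x y x' with |x| = m and
-- |y| = ℓ has exponent at least α exactly when m + ℓ ≤ (k-2) m, so α-freeness is a condition on
-- positions. With m = 1 it says that any k - 1 consecutive letters are distinct; with m = 2 it
-- forbids a factor ab reappearing as ab or as ba at distance at most 2k - 4.
-- Hence the letter at position s + k - 1 either repeats the letter at s, or is fresh: then the k
-- positions s, ..., s + k - 1 carry the whole alphabet, and the pigeonhole principle determines the
-- letters that follow. Two repeats in a row, three fresh letters in a row, and fresh-repeat-fresh
-- each produce a forbidden factor ab ... ab or ab ... ba, and no sequence of five steps avoids these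
-- patterns, so α-free words have length at most k + 3. The word 0 1 ... (k-2) 0 (k-1) 1 3 (ending in
-- 0 when k = 4) is α-free of length k + 3, and an r-free infinite word with r ≤ α would have an
-- α-free prefix of length k + 4, whence URT(k) ≥ α.
module Submission where

open import Defs
open import Data.Nat using (ℕ; zero; suc; _+_; _*_; _∸_; _<_; z≤n; s≤s) renaming (_≤_ to _≤ℕ_)
open import Data.Nat.Properties
open import Data.Nat.Tactic.RingSolver using (solve-∀)
open import Data.Fin using (Fin; toℕ; fromℕ<) renaming (zero to fzero; suc to fsuc)
import Data.Fin.Properties as Fin
open import Data.List using (List; []; _∷_; _++_; length; reverse; _∷ʳ_)
open import Data.List.Properties using (length-++; ++-assoc; unfold-reverse; ∷ʳ-injective; ∷-injective; length-reverse)
open import Data.Product using (Σ; _×_; _,_; proj₁; proj₂; ∃)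
open import Data.Sum using (_⊎_; inj₁; inj₂; [_,_]′)
open import Data.Empty using (⊥; ⊥-elim)
open import Relation.Nullary using (¬_; Dec; yes; no)
open import Relation.Binary.PropositionalEquality
open import Function.Bundles using (_⇔_; mk⇔; Equivalence)
import Function.Properties.Equivalence as ⇔
import Data.Rational as ℚ
import Data.Rational.Properties as ℚ
import Data.Rational.Unnormalised as ℚᵘ
import Data.Rational.Unnormalised.Properties as ℚᵘ
import Data.Integer as ℤ
import Data.Integer.Properties as ℤ

private variable
  A : Set

shift : ℕ → (ℕ → A) → ℕ → A
shift a g t = g (a + t)

length-prefix : ∀ (g : ℕ → A) n → length (prefix g n) ≡ n
length-prefix g zero    = refl
length-prefix g (suc n) = cong suc (length-prefix (shift 1 g) n)

prefix-++ : ∀ (g : ℕ → A) a b → prefix g (a + b) ≡ prefix g a ++ prefix (shift a g) b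
prefix-++ g zero    b = refl
prefix-++ g (suc a) b = cong (g 0 ∷_) (prefix-++ (shift 1 g) a b)

prefix-∷ʳ : ∀ (g : ℕ → A) n → prefix g (suc n) ≡ prefix g n ∷ʳ g n
prefix-∷ʳ g zero    = refl
prefix-∷ʳ g (suc n) = cong (g 0 ∷_) (prefix-∷ʳ (shift 1 g) n)

prefix-≡⇔ : ∀ (f h : ℕ → A) n → (∀ j → j < n → f j ≡ h j) ⇔ prefix f n ≡ prefix h n
prefix-≡⇔ f h n = mk⇔ (to n f h) (from n f h)
  where
  to : ∀ n (f h : ℕ → A) → (∀ j → j < n → f j ≡ h j) → prefix f n ≡ prefix h n
  to zero    f h same = refl
  to (suc n) f h same =
    cong₂ _∷_ (same 0 (s≤s z≤n)) (to n (shift 1 f) (shift 1 h) (λ j j<n → same (suc j) (s≤s j<n)))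
  from : ∀ n (f h : ℕ → A) → prefix f n ≡ prefix h n → ∀ j → j < n → f j ≡ h j
  from (suc n) f h eq zero    _         = proj₁ (∷-injective eq)
  from (suc n) f h eq (suc j) (s≤s j<n) = from n (shift 1 f) (shift 1 h) (proj₂ (∷-injective eq)) j j<n

prefix-reverse⇔ : ∀ (f h : ℕ → A) n →
  (∀ j j' → suc (j + j') ≡ n → f j ≡ h j') ⇔ prefix h n ≡ reverse (prefix f n)
prefix-reverse⇔ f h n = mk⇔ (to n f h) (from n f h)
  where
  to : ∀ n (f h : ℕ → A) → (∀ j j' → suc (j + j') ≡ n → f j ≡ h j') → prefix h n ≡ reverse (prefix f n)
  to zero    f h same = refl
  to (suc n) f h same = begin
    prefix h (suc n)                      ≡⟨ prefix-∷ʳ h n ⟩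
    prefix h n ∷ʳ h n                     ≡⟨ cong₂ _∷ʳ_ (to n (shift 1 f) h (λ j j' e → same (suc j) j' (cong suc e)))
                                                        (sym (same 0 n refl)) ⟩
    reverse (prefix (shift 1 f) n) ∷ʳ f 0 ≡⟨ sym (unfold-reverse (f 0) (prefix (shift 1 f) n)) ⟩
    reverse (prefix f (suc n))            ∎
    where open ≡-Reasoning
  from : ∀ n (f h : ℕ → A) → prefix h n ≡ reverse (prefix f n) → ∀ j j' → suc (j + j') ≡ n → f j ≡ h j'
  from (suc n) f h eq j j' e = split j j' e (∷ʳ-injective (prefix h n) (reverse (prefix (shift 1 f) n)) snoc)
    where
    snoc : prefix h n ∷ʳ h n ≡ reverse (prefix (shift 1 f) n) ∷ʳ f 0
    snoc = trans (sym (prefix-∷ʳ h n)) (trans eq (unfold-reverse (f 0) (prefix (shift 1 f) n)))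
    split : ∀ j j' → suc (j + j') ≡ suc n → prefix h n ≡ reverse (prefix (shift 1 f) n) × h n ≡ f 0 → f j ≡ h j'
    split zero    j' e (_    , last) = trans (sym last) (cong h (suc-injective (sym e)))
    split (suc j) j' e (init , _)    = from n (shift 1 f) h init j j' (suc-injective e)

prefix-shift-shift : ∀ (g : ℕ → A) a b n → prefix (shift a (shift b g)) n ≡ prefix (shift (b + a) g) n
prefix-shift-shift g a b n = Equivalence.to (prefix-≡⇔ _ _ n) (λ t _ → cong g (sym (+-assoc b a t)))

prefix-of-prefix : ∀ (g : ℕ → A) N v z → prefix g N ≡ v ++ z → v ≡ prefix g (length v) × length v ≤ℕ N
prefix-of-prefix g N       []      z eq = refl , z≤n
prefix-of-prefix g (suc N) (a ∷ v) z eq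
  with refl , eq' ← ∷-injective eq
  with v≡ , v≤N ← prefix-of-prefix (shift 1 g) N v z eq' = cong (g 0 ∷_) v≡ , s≤s v≤N

factor-of-prefix : ∀ (g : ℕ → A) N u v z → prefix g N ≡ u ++ v ++ z →
  v ≡ prefix (shift (length u) g) (length v) × length u + length v ≤ℕ N
factor-of-prefix g N       []      v z eq = prefix-of-prefix g N v z eq
factor-of-prefix g (suc N) (a ∷ u) v z eq
  with v≡ , uv≤N ← factor-of-prefix (shift 1 g) N u v z (proj₂ (∷-injective eq)) = v≡ , s≤s uv≤N

nth : A → List A → ℕ → A
nth d []      _       = d
nth d (a ∷ w) zero    = a
nth d (a ∷ w) (suc p) = nth d w p

prefix-nth : ∀ (d : A) w → prefix (nth d w) (length w) ≡ w
prefix-nth d []      = refl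
prefix-nth d (a ∷ w) = cong (a ∷_) (prefix-nth d w)

ratio-≤⇔ : ∀ a b c d → ratio a (suc b) ℚ.≤ ratio c (suc d) ⇔ a * suc d ≤ℕ c * suc b
ratio-≤⇔ a b c d = mk⇔ to from
  where
  p q : ℚᵘ.ℚᵘ
  p = ℚᵘ.mkℚᵘ (ℤ.+ a) b
  q = ℚᵘ.mkℚᵘ (ℤ.+ c) d
  to : ratio a (suc b) ℚ.≤ ratio c (suc d) → a * suc d ≤ℕ c * suc b
  to le with ℚᵘ.*≤* le' ← ℚᵘ.≤-respʳ-≃ (ℚ.toℚᵘ-fromℚᵘ q)
                              (ℚᵘ.≤-respˡ-≃ (ℚ.toℚᵘ-fromℚᵘ p) (ℚ.toℚᵘ-mono-≤ le))
    = ℤ.drop‿+≤+ (subst₂ ℤ._≤_ (sym (ℤ.pos-* a (suc d))) (sym (ℤ.pos-* c (suc b))) le')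
  from : a * suc d ≤ℕ c * suc b → ratio a (suc b) ℚ.≤ ratio c (suc d)
  from le = ℚ.toℚᵘ-cancel-≤ (ℚᵘ.≤-respʳ-≃ (ℚᵘ.≃-sym (ℚ.toℚᵘ-fromℚᵘ q))
              (ℚᵘ.≤-respˡ-≃ (ℚᵘ.≃-sym (ℚ.toℚᵘ-fromℚᵘ p))
              (ℚᵘ.*≤* (subst₂ ℤ._≤_ (ℤ.pos-* a (suc d)) (ℤ.pos-* c (suc b)) (ℤ.+≤+ le)))))

threshold : ℕ → ℚ.ℚ
threshold c = ratio (suc c) c

cross-multiplied⇔ : ∀ c m ℓ →
  suc (suc c) * suc (m + ℓ) ≤ℕ (suc m + (ℓ + suc m)) * suc c ⇔ suc m + ℓ ≤ℕ suc c * suc m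
cross-multiplied⇔ c m ℓ = mk⇔
  (λ le → +-cancelʳ-≤ (suc c * suc (m + ℓ)) _ _ (subst₂ _≤ℕ_ (lhs c m ℓ) (rhs c m ℓ) le))
  (λ le → subst₂ _≤ℕ_ (sym (lhs c m ℓ)) (sym (rhs c m ℓ)) (+-monoˡ-≤ (suc c * suc (m + ℓ)) le))
  where
  lhs : ∀ c m ℓ → suc (suc c) * suc (m + ℓ) ≡ suc m + ℓ + suc c * suc (m + ℓ)
  lhs = solve-∀
  rhs : ∀ c m ℓ → (suc m + (ℓ + suc m)) * suc c ≡ suc c * suc m + suc c * suc (m + ℓ)
  rhs = solve-∀

threshold≤exponent⇔ : ∀ c (x y x' : List A) → x ≢ [] → length x' ≡ length x →
  threshold (suc c) ℚ.≤ exponent x y x' ⇔ length x + length y ≤ℕ suc c * length x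
threshold≤exponent⇔ c []      y x' x≢[] _    = ⊥-elim (x≢[] refl)
threshold≤exponent⇔ c (a ∷ x) y x' _    ∣x'∣ =
  subst (λ e → threshold (suc c) ℚ.≤ e ⇔ suc m + ℓ ≤ℕ suc c * suc m) (sym exponent≡)
    (⇔.trans (ratio-≤⇔ (suc (suc c)) c (suc m + (ℓ + suc m)) (m + ℓ)) (cross-multiplied⇔ c m ℓ))
  where
  m ℓ : ℕ
  m = length x
  ℓ = length y
  exponent≡ : exponent (a ∷ x) y x' ≡ ratio (suc m + (ℓ + suc m)) (suc m + ℓ)
  exponent≡ = cong₂ ratio (cong suc (trans (length-++ x) (cong (m +_) (trans (length-++ y) (cong (ℓ +_) ∣x'∣)))))
                          (cong suc (length-++ x))

free-antitone : ∀ {α β} {w : List A} → α ℚ.≤ β → UFree α w → UFree β w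
free-antitone α≤β free u v z eq (x , y , x' , v≡ , x≢[] , x'≡ , β≤e) =
  free u v z eq (x , y , x' , v≡ , x≢[] , x'≡ , ℚ.≤-trans α≤β β≤e)

-- Powers in prefixes as repetitions of positions

data Reappears (g : ℕ → A) (i p m : ℕ) : Set where
  direct   : (∀ j → j < m → g (i + j) ≡ g (i + p + j)) → Reappears g i p m
  mirrored : (∀ j j' → suc (j + j') ≡ m → g (i + j) ≡ g (i + p + j')) → Reappears g i p m

-- An undirected power x y x' in g at position start, with |x| = width and |y| = gap; by
-- threshold≤exponent⇔, short says that its exponent is at least (c+1)/c.
record Repetition (c : ℕ) (g : ℕ → A) (N : ℕ) : Set where
  constructor repetition
  field
    start width gap : ℕ
    nonempty  : 0 < width
    short     : width + gap ≤ℕ c * width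
    fits      : start + (width + gap + width) ≤ℕ N
    reappears : Reappears g start (width + gap) width

blocks-of-factor : ∀ (g : ℕ → A) N u x y x' z → prefix g N ≡ u ++ (x ++ y ++ x') ++ z →
  x ≡ prefix (shift (length u) g) (length x) × x' ≡ prefix (shift (length u + (length x + length y)) g) (length x')
blocks-of-factor g N u x y x' z eq =
  proj₁ (factor-of-prefix g N u x ((y ++ x') ++ z) (trans eq (cong (u ++_) (++-assoc x (y ++ x') z)))) ,
  trans (proj₁ (factor-of-prefix g N (u ++ x ++ y) x' z regroup))
        (cong (λ a → prefix (shift a g) (length x')) (trans (length-++ u) (cong (length u +_) (length-++ x))))
  where
  regroup : prefix g N ≡ (u ++ x ++ y) ++ x' ++ z
  regroup = begin
    prefix g N               ≡⟨ eq ⟩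
    u ++ (x ++ y ++ x') ++ z ≡⟨ cong (u ++_) (++-assoc x (y ++ x') z) ⟩
    u ++ x ++ (y ++ x') ++ z ≡⟨ cong (λ t → u ++ x ++ t) (++-assoc y x' z) ⟩
    u ++ x ++ y ++ x' ++ z   ≡⟨ cong (u ++_) (sym (++-assoc x y (x' ++ z))) ⟩
    u ++ (x ++ y) ++ x' ++ z ≡⟨ sym (++-assoc u (x ++ y) (x' ++ z)) ⟩
    (u ++ x ++ y) ++ x' ++ z ∎
    where open ≡-Reasoning

power⇒repetition : ∀ c (g : ℕ → A) N u v z → prefix g N ≡ u ++ v ++ z →
  UPowerAtLeast (threshold (suc c)) v → Repetition (suc c) g N
power⇒repetition {A = A} c g N u v z eq (x , y , x' , refl , x≢[] , x'≡x∨xᴿ , le) =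
  repetition i m ℓ (nonempty x x≢[]) (Equivalence.to (threshold≤exponent⇔ c x y x' x≢[] ∣x'∣) le) fits reappears
  where
  i m ℓ : ℕ
  i = length u
  m = length x
  ℓ = length y
  nonempty : ∀ (x : List A) → x ≢ [] → 0 < length x
  nonempty []      x≢[] = ⊥-elim (x≢[] refl)
  nonempty (_ ∷ _) _    = s≤s z≤n
  ∣x'∣ : length x' ≡ m
  ∣x'∣ = [ cong length , (λ x'≡xᴿ → trans (cong length x'≡xᴿ) (length-reverse x)) ]′ x'≡x∨xᴿ
  fits : i + (m + ℓ + m) ≤ℕ N
  fits = subst (λ n → i + n ≤ℕ N) ∣xyx'∣ (proj₂ (factor-of-prefix g N u (x ++ y ++ x') z eq))
    where
    ∣xyx'∣ : length (x ++ y ++ x') ≡ m + ℓ + m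
    ∣xyx'∣ = trans (length-++ x) (trans (cong (m +_) (trans (length-++ y) (cong (ℓ +_) ∣x'∣))) (sym (+-assoc m ℓ m)))
  x≡ : x ≡ prefix (shift i g) m
  x≡ = proj₁ (blocks-of-factor g N u x y x' z eq)
  x'≡ : x' ≡ prefix (shift (i + (m + ℓ)) g) m
  x'≡ = trans (proj₂ (blocks-of-factor g N u x y x' z eq)) (cong (prefix _) ∣x'∣)
  reappears : Reappears g i (m + ℓ) m
  reappears = [ (λ x'≡x → direct (Equivalence.from (prefix-≡⇔ _ _ m) (sym (trans (sym x'≡) (trans x'≡x x≡)))))
              , (λ x'≡xᴿ → mirrored (Equivalence.from (prefix-reverse⇔ _ _ m)
                                      (trans (sym x'≡) (trans x'≡xᴿ (cong reverse x≡))))) ]′ x'≡x∨xᴿ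

reappearing-blocks : ∀ {g : ℕ → A} {i p m} → Reappears g i p m →
  (prefix (shift (i + p) g) m ≡ prefix (shift i g) m) ⊎ (prefix (shift (i + p) g) m ≡ reverse (prefix (shift i g) m))
reappearing-blocks {m = m} (direct same)   = inj₁ (sym (Equivalence.to (prefix-≡⇔ _ _ m) same))
reappearing-blocks {m = m} (mirrored same) = inj₂ (Equivalence.to (prefix-reverse⇔ _ _ m) same)

repetition⇒¬free : ∀ c (g : ℕ → A) N → Repetition (suc c) g N → ¬ UFree (threshold (suc c)) (prefix g N)
repetition⇒¬free c g N (repetition i zero    ℓ () short fits reappears)
repetition⇒¬free {A = A} c g N (repetition i (suc m) ℓ _  short fits reappears) free =
  free u (x ++ y ++ x') z decomposition (x , y , x' , refl , (λ ()) , reappearing-blocks reappears , above-threshold)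
  where
  h : ℕ → A
  h = shift i g
  p r : ℕ
  p = suc m + ℓ
  r = proj₁ (m≤n⇒∃[o]m+o≡n fits)
  u x y x' z : List A
  u = prefix g i
  x = prefix h (suc m)
  y = prefix (shift (suc m) h) ℓ
  x' = prefix (shift (i + p) g) (suc m)
  z = prefix (shift (i + (p + suc m)) g) r
  decomposition : prefix g N ≡ u ++ (x ++ y ++ x') ++ z
  decomposition = begin
    prefix g N                                             ≡⟨ cong (prefix g) (sym (proj₂ (m≤n⇒∃[o]m+o≡n fits))) ⟩
    prefix g (i + (p + suc m) + r)                         ≡⟨ prefix-++ g (i + (p + suc m)) r ⟩
    prefix g (i + (p + suc m)) ++ z                        ≡⟨ cong (_++ z) (prefix-++ g i (p + suc m)) ⟩
    (u ++ prefix h (p + suc m)) ++ z                       ≡⟨ ++-assoc u _ z ⟩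
    u ++ prefix h (p + suc m) ++ z                         ≡⟨ cong (λ t → u ++ t ++ z) (prefix-++ h p (suc m)) ⟩
    u ++ (prefix h p ++ prefix (shift p h) (suc m)) ++ z   ≡⟨ cong (λ t → u ++ (t ++ prefix (shift p h) (suc m)) ++ z)
                                                                   (prefix-++ h (suc m) ℓ) ⟩
    u ++ ((x ++ y) ++ prefix (shift p h) (suc m)) ++ z     ≡⟨ cong (λ t → u ++ t ++ z) (++-assoc x y _) ⟩
    u ++ (x ++ y ++ prefix (shift p h) (suc m)) ++ z       ≡⟨ cong (λ t → u ++ (x ++ y ++ t) ++ z)
                                                                   (prefix-shift-shift g p i (suc m)) ⟩
    u ++ (x ++ y ++ x') ++ z                               ∎
    where open ≡-Reasoning
  above-threshold : threshold (suc c) ℚ.≤ exponent x y x'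
  above-threshold = Equivalence.from (threshold≤exponent⇔ c x y x' (λ ()) (trans ∣x'∣ (sym ∣x∣)))
                      (subst₂ (λ a b → a + b ≤ℕ suc c * a) (sym ∣x∣) (sym (length-prefix _ ℓ)) short)
    where
    ∣x∣ : length x ≡ suc m
    ∣x∣ = length-prefix h (suc m)
    ∣x'∣ : length x' ≡ suc m
    ∣x'∣ = length-prefix (shift (i + p) g) (suc m)

free⇔no-repetition : ∀ c (g : ℕ → A) N → UFree (threshold (suc c)) (prefix g N) ⇔ (¬ Repetition (suc c) g N)
free⇔no-repetition c g N = mk⇔ (λ free rep → repetition⇒¬free c g N rep free)
                              (λ norep u v z eq power → norep (power⇒repetition c g N u v z eq power))

no-repetition-mono : ∀ {c} {g : ℕ → A} {N N'} → N ≤ℕ N' → ¬ Repetition c g N' → ¬ Repetition c g N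
no-repetition-mono N≤N' norep (repetition i m ℓ m>0 short fits reappears) =
  norep (repetition i m ℓ m>0 short (≤-trans fits N≤N') reappears)

no-repetition-shift : ∀ {c} {g : ℕ → A} {N} → ¬ Repetition c g (suc N) → ¬ Repetition c (shift 1 g) N
no-repetition-shift norep (repetition i m ℓ m>0 short fits (direct same)) =
  norep (repetition (suc i) m ℓ m>0 short (s≤s fits) (direct same))
no-repetition-shift norep (repetition i m ℓ m>0 short fits (mirrored same)) =
  norep (repetition (suc i) m ℓ m>0 short (s≤s fits) (mirrored same))

near-distinct : ∀ {c} {h : ℕ → A} {N} → ¬ Repetition c h N → ∀ {t u} → t < u → u ≤ℕ t + c → u < N → h t ≢ h u
near-distinct {c = c} {h} {N} norep {t} {u} t<u u≤t+c u<N ht≡hu =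
  norep (repetition t 1 o (s≤s z≤n) short fits (direct λ { zero _ → same ; (suc _) (s≤s ()) }))
  where
  end-of-pair : ∀ t o → t + (1 + o + 1) ≡ suc (suc t + o)
  end-of-pair = solve-∀
  second-of-pair : ∀ t o → t + (1 + o) + 0 ≡ suc t + o
  second-of-pair = solve-∀
  o : ℕ
  o = proj₁ (m≤n⇒∃[o]m+o≡n t<u)
  u≡ : suc t + o ≡ u
  u≡ = proj₂ (m≤n⇒∃[o]m+o≡n t<u)
  short : 1 + o ≤ℕ c * 1
  short = subst (1 + o ≤ℕ_) (sym (*-identityʳ c))
            (+-cancelˡ-≤ t _ _ (subst (_≤ℕ t + c) (trans (sym u≡) (sym (+-suc t o))) u≤t+c))
  fits : t + (1 + o + 1) ≤ℕ N
  fits = subst (_≤ℕ N) (trans (cong suc (sym u≡)) (sym (end-of-pair t o))) u<N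
  same : h (t + 0) ≡ h (t + (1 + o) + 0)
  same = subst₂ (λ a b → h a ≡ h b) (sym (+-identityʳ t)) (trans (sym u≡) (sym (second-of-pair t o))) ht≡hu

module _ {c : ℕ} {h : ℕ → A} {N : ℕ} (o : ℕ) (norep : ¬ Repetition c h N)
         (short : 2 + o ≤ℕ c * 2) (fits : 4 + o ≤ℕ N) where

  private
    +0 : 2 + o + 0 ≡ 2 + o
    +0 = +-identityʳ (2 + o)
    +1 : 2 + o + 1 ≡ 3 + o
    +1 = +-comm (2 + o) 1
    fits′ : 0 + (2 + o + 2) ≤ℕ N
    fits′ = subst (_≤ℕ N) (+-comm 2 (2 + o)) fits

  no-repeated-pair : h 0 ≡ h (2 + o) → h 1 ≡ h (3 + o) → ⊥
  no-repeated-pair first second = norep (repetition 0 2 o (s≤s z≤n) short fits′ (direct same))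
    where
    same : ∀ j → j < 2 → h j ≡ h (2 + o + j)
    same zero          _ = subst (λ p → h 0 ≡ h p) (sym +0) first
    same (suc zero)    _ = subst (λ p → h 1 ≡ h p) (sym +1) second
    same (suc (suc j)) (s≤s (s≤s ()))

  no-mirrored-pair : h 0 ≡ h (3 + o) → h 1 ≡ h (2 + o) → ⊥
  no-mirrored-pair first second = norep (repetition 0 2 o (s≤s z≤n) short fits′ (mirrored same))
    where
    same : ∀ j j' → suc (j + j') ≡ 2 → h j ≡ h (2 + o + j')
    same zero          (suc zero)    _ = subst (λ p → h 0 ≡ h p) (sym +1) first
    same (suc zero)    zero          _ = subst (λ p → h 1 ≡ h p) (sym +0) second
    same zero          zero          ()
    same zero          (suc (suc _)) ()
    same (suc zero)    (suc _)       ()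
    same (suc (suc _)) _             ()

-- The alphabet has k = 4 + n letters; c = k - 2 is the denominator of the threshold and K = k - 1.
module Alphabet (n : ℕ) where

  c K : ℕ
  c = 2 + n
  K = 3 + n

  Word : Set
  Word = ℕ → Fin (4 + n)

  -- Every word of length k + 4 contains a repetition

  window-distinct : ∀ {h : Word} {N} → ¬ Repetition c h N → K < N → h K ≢ h 0 →
    ∀ {t u} → t < u → u ≤ℕ K → h t ≢ h u
  window-distinct {h} norep K<N fresh {t} {u} t<u u≤K with u ≤? t + c
  ... | yes u≤t+c = near-distinct norep t<u u≤t+c (≤-<-trans u≤K K<N)
  ... | no  u≰t+c = λ ht≡hu → fresh (subst₂ (λ a b → h a ≡ h b) u≡K t≡0 (sym ht≡hu))
    where
    t+c<u : suc (t + c) ≤ℕ u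
    t+c<u = ≰⇒> u≰t+c
    t≡0 : t ≡ 0
    t≡0 = n≤0⇒n≡0 (+-cancelʳ-≤ c t 0 (≤-pred (≤-trans t+c<u u≤K)))
    u≡K : u ≡ K
    u≡K = ≤-antisym u≤K (≤-trans (s≤s (m≤n+m c t)) t+c<u)

  every-letter-in-window : ∀ {h : Word} {N} → ¬ Repetition c h N → K < N → h K ≢ h 0 →
    ∀ a → ∃ λ t → t ≤ℕ K × h t ≡ a
  every-letter-in-window {h} norep K<N fresh a with Fin.pigeonhole (n<1+n (4 + n)) f
    where
    f : Fin (5 + n) → Fin (4 + n)
    f fzero    = a
    f (fsuc t) = h (toℕ t)
  ... | fzero  , fsuc t  , _        , a≡ht   = toℕ t , ≤-pred (Fin.toℕ<n t) , sym a≡ht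
  ... | fsuc t , fsuc t' , s≤s t<t' , ht≡ht' =
    ⊥-elim (window-distinct norep K<N fresh t<t' (≤-pred (Fin.toℕ<n t')) ht≡ht')
  ... | fzero  , fzero   , () , _
  ... | fsuc _ , fzero   , () , _

  fill-window : ∀ {h : Word} {N} → ¬ Repetition c h N → K < N → h K ≢ h 0 →
    ∀ {a} → (∀ t → 0 < t → t ≤ℕ K → a ≢ h t) → a ≡ h 0
  fill-window norep K<N fresh {a} differs with every-letter-in-window norep K<N fresh a
  ... | zero  , _   , h0≡a = sym h0≡a
  ... | suc t , t≤K , ht≡a = ⊥-elim (differs (suc t) (s≤s z≤n) t≤K (sym ht≡a))

  Repeats : Word → ℕ → Set
  Repeats h s = h (s + K) ≡ h s

  repeats? : ∀ h s → Dec (Repeats h s)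
  repeats? h s = h (s + K) Fin.≟ h s

  private
    period-K-short : 3 + n ≤ℕ c * 2
    period-K-short = s≤s (s≤s (s≤s (m≤n⇒m≤1+n (m≤m*n n 2))))
    period-1+K-short : 4 + n ≤ℕ c * 2
    period-1+K-short = +-monoʳ-≤ 4 (m≤m*n n 2)

  no-two-repeats : ∀ {h : Word} → ¬ Repetition c h (2 + K) → Repeats h 0 → Repeats h 1 → ⊥
  no-two-repeats norep r₀ r₁ = no-repeated-pair (1 + n) norep period-K-short ≤-refl (sym r₀) (sym r₁)

  two-fresh : ∀ {h : Word} → ¬ Repetition c h (2 + K) → ¬ Repeats h 0 → ¬ Repeats h 1 → h (1 + K) ≡ h 0
  two-fresh {h} norep f₀ f₁ = fill-window norep (m<n⇒m<1+n (n<1+n K)) f₀ differs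
    where
    differs : ∀ t → 0 < t → t ≤ℕ K → h (1 + K) ≢ h t
    differs (suc zero)    _ _   = f₁
    differs (suc (suc t)) _ t≤K = ≢-sym (near-distinct norep (s≤s t≤K) (s≤s (s≤s (m≤n+m c t))) ≤-refl)

  no-three-fresh : ∀ {h : Word} → ¬ Repetition c h (3 + K) → ¬ Repeats h 0 → ¬ Repeats h 1 → ¬ Repeats h 2 → ⊥
  no-three-fresh norep f₀ f₁ f₂ =
    no-repeated-pair (2 + n) norep period-1+K-short ≤-refl
      (sym (two-fresh (no-repetition-mono (n≤1+n _) norep) f₀ f₁))
      (sym (two-fresh (no-repetition-shift norep) f₁ f₂))

  no-fresh-repeat-fresh : ∀ {h : Word} → ¬ Repetition c h (3 + K) → ¬ Repeats h 0 → Repeats h 1 → ¬ Repeats h 2 → ⊥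
  no-fresh-repeat-fresh {h} norep f₀ r₁ f₂ = no-mirrored-pair (2 + n) norep period-1+K-short ≤-refl (sym h[2+K]≡h0) (sym r₁)
    where
    differs : ∀ t → 0 < t → t ≤ℕ K → h (2 + K) ≢ h t
    differs (suc zero)          _ _   e =
      near-distinct norep (n<1+n (suc K)) (s≤s (m<m+n K (s≤s z≤n))) ≤-refl (trans r₁ (sym e))
    differs (suc (suc zero))    _ _     = f₂
    differs (suc (suc (suc t))) _ t≤K   =
      ≢-sym (near-distinct norep (s≤s (m≤n⇒m≤1+n t≤K)) (s≤s (s≤s (s≤s (m≤n+m c t)))) ≤-refl)
    h[2+K]≡h0 : h (2 + K) ≡ h 0
    h[2+K]≡h0 = fill-window norep (m<n⇒m<1+n (m<n⇒m<1+n (n<1+n K))) f₀ differs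

  no-fresh-then-repeat : ∀ {h : Word} → ¬ Repetition c h (3 + K) → ¬ Repeats h 0 → Repeats h 1 → ⊥
  no-fresh-then-repeat {h} norep f₀ r₁ with repeats? h 2
  ... | yes r₂ = no-two-repeats (no-repetition-shift norep) r₁ r₂
  ... | no  f₂ = no-fresh-repeat-fresh norep f₀ r₁ f₂

  repetition-unavoidable : ∀ (g : Word) → ¬ Repetition c g (5 + K) → ⊥
  repetition-unavoidable g norep with repeats? g 0 | repeats? g 1 | repeats? g 2 | repeats? g 3
  ... | yes r₀ | yes r₁ | _      | _      = no-two-repeats (no-repetition-mono (m≤n+m _ 3) norep) r₀ r₁
  ... | yes _  | no  f₁ | yes r₂ | _      = no-fresh-then-repeat (no-repetition-mono (n≤1+n _) (no-repetition-shift norep)) f₁ r₂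
  ... | yes _  | no  f₁ | no  f₂ | no  f₃ = no-three-fresh (no-repetition-mono (n≤1+n _) (no-repetition-shift norep)) f₁ f₂ f₃
  ... | yes _  | no  _  | no  f₂ | yes r₃ = no-fresh-then-repeat (no-repetition-shift (no-repetition-shift norep)) f₂ r₃
  ... | no  f₀ | yes r₁ | _      | _      = no-fresh-then-repeat (no-repetition-mono (m≤n+m _ 2) norep) f₀ r₁
  ... | no  f₀ | no  f₁ | no  f₂ | _      = no-three-fresh (no-repetition-mono (m≤n+m _ 2) norep) f₀ f₁ f₂
  ... | no  _  | no  f₁ | yes r₂ | _      = no-fresh-then-repeat (no-repetition-mono (n≤1+n _) (no-repetition-shift norep)) f₁ r₂

  -- A repetition-free word of length k + 3

  -- code p is the letter at position p of 0 1 ... (k-2) 0 (k-1) 1 ℓ, where ℓ is the letter at position 3: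
  -- ℓ = 3 if k > 4, while for k = 4 position 3 = K carries 0.
  letter-at-3 : ℕ → ℕ
  letter-at-3 zero    = 0
  letter-at-3 (suc _) = 3

  tail-letter : ℕ → ℕ
  tail-letter 0 = 0
  tail-letter 1 = K
  tail-letter 2 = 1
  tail-letter _ = letter-at-3 n

  code : ℕ → ℕ
  code p with p <? K
  ... | yes _ = p
  ... | no  _ = tail-letter (p ∸ K)

  code-head : ∀ {p} → p < K → code p ≡ p
  code-head {p} p<K with p <? K
  ... | yes _   = refl
  ... | no  p≮K = ⊥-elim (p≮K p<K)

  code-tail : ∀ r → code (r + K) ≡ tail-letter r
  code-tail r with r + K <? K
  ... | yes r+K<K = ⊥-elim (<-irrefl refl (≤-trans r+K<K (m≤n+m K r)))
  ... | no  _     = cong tail-letter (m+n∸n≡m r K)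

  letter-at-3≤3 : ∀ m → letter-at-3 m ≤ℕ 3
  letter-at-3≤3 zero    = z≤n
  letter-at-3≤3 (suc _) = ≤-refl

  code<4+n : ∀ p → code p < 4 + n
  code<4+n p with p <? K
  ... | yes p<K = m<n⇒m<1+n p<K
  ... | no  _   = tail-bound (p ∸ K)
    where
    tail-bound : ∀ r → tail-letter r < 4 + n
    tail-bound 0 = s≤s z≤n
    tail-bound 1 = ≤-refl
    tail-bound 2 = s≤s (s≤s z≤n)
    tail-bound (suc (suc (suc _))) = s≤s (≤-trans (letter-at-3≤3 n) (m≤m+n 3 n))

  witness : ℕ → Fin (4 + n)
  witness p = fromℕ< (code<4+n p)

  witness-code : ∀ {p q} → witness p ≡ witness q → code p ≡ code q
  witness-code {p} {q} e = trans (sym (Fin.toℕ-fromℕ< (code<4+n p))) (trans (cong toℕ e) (Fin.toℕ-fromℕ< (code<4+n q)))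

  data Position : ℕ → Set where
    head : ∀ {p} → p < K → Position p
    tail : ∀ r → Position (r + K)

  position : ∀ p → Position p
  position p with p <? K
  ... | yes p<K = head p<K
  ... | no  p≮K = subst Position (m∸n+n≡m (≮⇒≥ p≮K)) (tail (p ∸ K))

  data Twin : ℕ → ℕ → Set where
    twin₀ : Twin 0 K
    twin₁ : Twin 1 (2 + K)
    twin₃ : ∀ {p} → code p ≡ letter-at-3 n → p ≤ℕ 3 → Twin p (3 + K)

  0≡letter-at-3⇒≡0 : ∀ m → 0 ≡ letter-at-3 m → m ≡ 0
  0≡letter-at-3⇒≡0 zero _ = refl

  K≢letter-at-3 : ∀ m → 3 + m ≢ letter-at-3 m
  K≢letter-at-3 zero    ()
  K≢letter-at-3 (suc m) ()

  small≢letter-at-3 : ∀ {a} m → 0 < a → a < 3 → a ≢ letter-at-3 m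
  small≢letter-at-3 zero    (s≤s _) _ ()
  small≢letter-at-3 (suc m) _ (s≤s (s≤s (s≤s ()))) refl

  twin : ∀ {p q} → p < q → q < 4 + K → code p ≡ code q → Twin p q
  twin {p} {q} p<q q<N e with position q
  ... | head q<K = ⊥-elim (<-irrefl (trans (sym (code-head (<-trans p<q q<K))) (trans e (code-head q<K))) p<q)
  ... | tail 0 with position p
  ...   | head p<K = subst (λ p → Twin p K) (sym (trans (sym (code-head p<K)) (trans e (code-tail 0)))) twin₀
  ...   | tail r   = ⊥-elim (m+n≮n r K p<q)
  twin {p} p<q q<N e | tail 1 with position p | trans e (code-tail 1)
  ...   | head p<K     | e' = ⊥-elim (<-irrefl (trans (sym (code-head p<K)) e') p<K)
  ...   | tail 0       | e' = ⊥-elim (0≢1+n (trans (sym (code-tail 0)) e'))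
  ...   | tail (suc r) | _  = ⊥-elim (m+n≮n r K (≤-pred p<q))
  twin {p} p<q q<N e | tail 2 with position p | trans e (code-tail 2)
  ...   | head p<K           | e' = subst (λ p → Twin p (2 + K)) (sym (trans (sym (code-head p<K)) e')) twin₁
  ...   | tail 0             | e' = ⊥-elim (0≢1+n (trans (sym (code-tail 0)) e'))
  ...   | tail 1             | e' = ⊥-elim (1+n≢0 (suc-injective (trans (sym (code-tail 1)) e')))
  ...   | tail (suc (suc r)) | _  = ⊥-elim (m+n≮n r K (≤-pred (≤-pred p<q)))
  twin {p} p<q q<N e | tail 3 = twin₃ e' (p≤3 (position p) e')
    where
    e' : code p ≡ letter-at-3 n
    e' = trans e (code-tail 3)
    p≤3 : Position p → code p ≡ letter-at-3 n → p ≤ℕ 3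
    p≤3 (head p<K) e' = subst (_≤ℕ 3) (sym (trans (sym (code-head p<K)) e')) (letter-at-3≤3 n)
    p≤3 (tail 0)   e' rewrite 0≡letter-at-3⇒≡0 n (trans (sym (code-tail 0)) e') = ≤-refl
    p≤3 (tail 1)   e' = ⊥-elim (K≢letter-at-3 n (trans (sym (code-tail 1)) e'))
    p≤3 (tail 2)   e' = ⊥-elim (small≢letter-at-3 n (s≤s z≤n) (s≤s (s≤s z≤n)) (trans (sym (code-tail 2)) e'))
    p≤3 (tail (suc (suc (suc r)))) _ = ⊥-elim (m+n≮n r K (≤-pred (≤-pred (≤-pred p<q))))
  twin p<q q<N e | tail (suc (suc (suc (suc r)))) = ⊥-elim (m+n≮n r K (≤-pred (≤-pred (≤-pred (≤-pred q<N)))))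

  twin-far : ∀ {p q} → Twin p q → p + K ≤ℕ q
  twin-far twin₀          = ≤-refl
  twin-far twin₁          = n≤1+n _
  twin-far (twin₃ _ p≤3) = +-monoˡ-≤ K p≤3

  no-repeated-twins : ∀ {p q} → Twin p q → Twin (suc p) (suc q) → ⊥
  no-repeated-twins twin₀ ()
  no-repeated-twins twin₁ (twin₃ e _) =
    small≢letter-at-3 n (s≤s z≤n) (s≤s (s≤s (s≤s z≤n))) (trans (sym (code-head (s≤s (s≤s (s≤s z≤n))))) e)
  no-repeated-twins (twin₃ _ _) ()

  mirrored-twins : ∀ {i j} → Twin i (suc j) → Twin (suc i) j → i ≡ 0 × j ≡ 2 + K × n ≡ 0
  mirrored-twins (twin₃ e _) twin₁ = refl , refl , 0≡letter-at-3⇒≡0 n (trans (sym (code-head (s≤s z≤n))) e)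

  no-twin-at-1+K : ∀ {p} → Twin p (1 + K) → ⊥
  no-twin-at-1+K ()

  witness-twin : ∀ {p q} → p < q → q < 4 + K → witness p ≡ witness q → Twin p q
  witness-twin {p} {q} p<q q<N e = twin p<q q<N (witness-code {p} {q} e)

  no-single-letter-repetition : ∀ {i ℓ} → suc ℓ ≤ℕ c * 1 → i + (1 + ℓ + 1) ≤ℕ 4 + K →
    Reappears witness i (1 + ℓ) 1 → ⊥
  no-single-letter-repetition {i} {ℓ} short fits reappears =
    n≮n c (≤-trans (+-cancelˡ-≤ i K (suc ℓ) (twin-far (witness-twin i<q q<N (first-letter reappears))))
                   (subst (suc ℓ ≤ℕ_) (*-identityʳ c) short))
    where
    i<q : i < i + suc ℓ
    i<q = m<m+n i (s≤s z≤n)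
    q<N : i + suc ℓ < 4 + K
    q<N = <-≤-trans (+-monoʳ-< i (m<m+n (suc ℓ) (s≤s z≤n))) fits
    first-letter : Reappears witness i (1 + ℓ) 1 → witness i ≡ witness (i + suc ℓ)
    first-letter (direct same)   = subst₂ (λ a b → witness a ≡ witness b) (+-identityʳ i) (+-identityʳ (i + suc ℓ))
                                          (same 0 (s≤s z≤n))
    first-letter (mirrored same) = subst₂ (λ a b → witness a ≡ witness b) (+-identityʳ i) (+-identityʳ (i + suc ℓ))
                                          (same 0 0 refl)

  private
    last-pair-end : ∀ i p m → i + (p + (2 + m)) ≡ 2 + (i + p + m)
    last-pair-end = solve-∀

  no-direct-repetition : ∀ {i m ℓ} → i + (2 + m + ℓ + (2 + m)) ≤ℕ 4 + K →
    (∀ j → j < 2 + m → witness (i + j) ≡ witness (i + (2 + m + ℓ) + j)) → ⊥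
  no-direct-repetition {i} {m} {ℓ} fits same =
    no-repeated-twins (witness-twin (m<m+n i (s≤s z≤n)) (<-trans (n<1+n _) i+p<N) first)
                      (witness-twin (s≤s (m<m+n i (s≤s z≤n))) i+p<N second)
    where
    p : ℕ
    p = 2 + m + ℓ
    i+p<N : suc (i + p) < 4 + K
    i+p<N = ≤-<-trans (s≤s (m≤m+n (i + p) m)) (subst (_≤ℕ 4 + K) (last-pair-end i p m) fits)
    first : witness i ≡ witness (i + p)
    first = subst₂ (λ a b → witness a ≡ witness b) (+-identityʳ i) (+-identityʳ (i + p)) (same 0 (s≤s z≤n))
    second : witness (suc i) ≡ witness (suc (i + p))
    second = subst₂ (λ a b → witness a ≡ witness b) (+-comm i 1) (+-comm (i + p) 1) (same 1 (s≤s (s≤s z≤n)))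

  -- Mirrored twins occur only for k = 4, as 0 1 ... 1 0 at positions 0, 1, 2 + K, 3 + K. They are too far
  -- apart for a block of width 2, and a wider block would also pair position 2 with 1 + K.
  no-mirrored-repetition : ∀ {i m ℓ} → 2 + m + ℓ ≤ℕ c * (2 + m) → i + (2 + m + ℓ + (2 + m)) ≤ℕ 4 + K →
    (∀ j j' → suc (j + j') ≡ 2 + m → witness (i + j) ≡ witness (i + (2 + m + ℓ) + j')) → ⊥
  no-mirrored-repetition {i} {m} {ℓ} short fits same
    with mirrored-twins (witness-twin (s≤s (≤-trans (m≤m+n i p) (m≤m+n (i + p) m))) q<N outer)
                        (witness-twin inner-start (<-trans (n<1+n q) q<N) inner)
    where
    p q : ℕ
    p = 2 + m + ℓ
    q = i + p + m
    q<N : suc q < 4 + K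
    q<N = subst (_≤ℕ 4 + K) (last-pair-end i p m) fits
    outer : witness i ≡ witness (suc q)
    outer = subst₂ (λ a b → witness a ≡ witness b) (+-identityʳ i) (+-suc (i + p) m) (same 0 (suc m) refl)
    inner : witness (suc i) ≡ witness q
    inner = subst (λ a → witness a ≡ witness q) (+-comm i 1) (same 1 m refl)
    inner-start : suc i < q
    inner-start = ≤-trans (subst (_≤ℕ i + p) (+-comm i 2) (+-monoʳ-≤ i (s≤s (s≤s z≤n)))) (m≤m+n (i + p) m)
  ... | refl , q≡2+K , n≡0 = third-pair m short q≡2+K same
    where
    third-pair : ∀ m → 2 + m + ℓ ≤ℕ c * (2 + m) → 0 + (2 + m + ℓ) + m ≡ 2 + K →
      (∀ j j' → suc (j + j') ≡ 2 + m → witness (0 + j) ≡ witness (0 + (2 + m + ℓ) + j')) → ⊥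
    third-pair zero    short q≡2+K _    = too-long (subst (_≤ℕ c * 2) (trans (sym (+-identityʳ (2 + ℓ))) q≡2+K) short)
      where
      too-long : 2 + K ≤ℕ c * 2 → ⊥
      too-long le with subst (λ k → 5 + k ≤ℕ 4 + k * 2) n≡0 le
      ... | s≤s (s≤s (s≤s (s≤s ())))
    third-pair (suc m) _     q≡2+K same =
      no-twin-at-1+K (witness-twin (s≤s (s≤s (s≤s z≤n))) (≤-trans (n≤1+n (2 + K)) (n≤1+n (3 + K)))
                       (subst (λ a → witness 2 ≡ witness a) (suc-injective (trans (sym (+-suc (3 + m + ℓ) m)) q≡2+K))
                              (same 2 m refl)))

  no-repetition-in-witness : ¬ Repetition c witness (4 + K)
  no-repetition-in-witness (repetition i zero          ℓ () _     _    _)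
  no-repetition-in-witness (repetition i 1             ℓ _  short fits reappears) =
    no-single-letter-repetition short fits reappears
  no-repetition-in-witness (repetition i (suc (suc m)) ℓ _  _     fits (direct same)) =
    no-direct-repetition fits same
  no-repetition-in-witness (repetition i (suc (suc m)) ℓ _  short fits (mirrored same)) =
    no-mirrored-repetition short fits same


  free-words-are-short : ∀ (w : List (Fin (4 + n))) → UFree (threshold c) w → length w ≤ℕ 4 + n + 3
  free-words-are-short w free with length w ≤? 4 + n + 3
  ... | yes short = short
  ... | no  long  = ⊥-elim (repetition-unavoidable (nth fzero w)
                      (no-repetition-mono long′ (Equivalence.to (free⇔no-repetition (1 + n) (nth fzero w) (length w))
                                                   (subst (UFree (threshold c)) (sym (prefix-nth fzero w)) free))))
    where
    long′ : 8 + n ≤ℕ length w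
    long′ = subst (λ k → suc k ≤ℕ length w) (cong (4 +_) (+-comm n 3)) (≰⇒> long)

  urt-bound : URT≥ (4 + n) (threshold c)
  urt-bound r (f , free) with ℚ.≤-total (threshold c) r
  ... | inj₁ α≤r = α≤r
  ... | inj₂ r≤α = ⊥-elim (repetition-unavoidable f
                     (Equivalence.to (free⇔no-repetition (1 + n) f (8 + n)) (free-antitone r≤α (free (8 + n)))))

  longest-free-word : Σ (List (Fin (4 + n))) λ w → (length w ≡ 4 + n + 3) × UFree (threshold c) w
  longest-free-word =
    prefix witness (7 + n) ,
    trans (length-prefix witness (7 + n)) (cong (4 +_) (+-comm 3 n)) ,
    Equivalence.from (free⇔no-repetition (1 + n) witness (7 + n)) no-repetition-in-witness

theorem3 : (k : ℕ) → 4 ≤ℕ k →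
    URT≥ k (ratio (k ∸ 1) (k ∸ 2))
    × (Σ (List (Fin k)) λ w → (length w ≡ k + 3) × UFree (ratio (k ∸ 1) (k ∸ 2)) w)
    × ((w : List (Fin k)) → UFree (ratio (k ∸ 1) (k ∸ 2)) w → length w ≤ℕ k + 3)
theorem3 _ (s≤s (s≤s (s≤s (s≤s (z≤n {n}))))) = urt-bound , longest-free-word , free-words-are-short
  where open Alphabet n
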